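{- Let $F$ and $K$ be finite fields with $|F|\geq 3$. Then $$\gamma^o(\Gamma(\mathbb{Z}_2 \times K \times F)) = 1 + \min \left\{ 2|K^*|,\ 2|F^*|,\ |F^*| + \left\lfloor \frac{|K^*|}{2} \right\rfloor + 1,\ |K^*|+ \left\lfloor \frac{|F^*|}{2} \right\rfloor + 1 \right\}.$$
   Context: $K^*=K\setminus\{0\}$, $F^*=F\setminus\{0\}$. For a finite commutative ring $R$ with identity, the zero-divisor graph $\Gamma(R)$ is the simple graph whose vertex set is the set of nonzero zero-divisors of $R$, in which distinct $u,v$ are adjacent if and only if $uv=0$. For a simple graph $\Gamma=(V,E)$, a set $S\subseteq V$ and a vertex $v$, let $\delta_S(v)$ be the number of neighbors of $v$ in $S$ and $\overline{S}=V\setminus S$. A nonempty set $S\subseteq V$ is a global offensive alliance if $\delta_S(v)\geq \delta_{\overline{S}}(v)+1$ for every $v\in\overline{S}$. $\gamma^o(\Gamma)$ is the minimum cardinality of a global offensive alliance of $\Gamma$. -}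

module Defs where

open import Level using (Level; _⊔_)
open import Data.Bool using (Bool; true; false; not; _∧_; _∨_; if_then_else_)
open import Data.Bool.Properties using () renaming (_≟_ to _≟B_)
open import Data.Nat using (ℕ; zero; suc; _+_; _∸_; _≤_; _⊓_; ⌊_/2⌋)
open import Data.List using (List; []; _∷_; length; map; concatMap)
open import Data.Bool.ListAction using (any)
open import Data.List.Relation.Unary.All using (All)
open import Data.Product using (Σ; _×_; _,_; ∃; ∃-syntax)
open import Relation.Nullary using (¬_; Dec; does)
open import Relation.Binary.PropositionalEquality using (_≡_)
open import Algebra.Bundles using (CommutativeRing)

filterᵇ : ∀ {a} {A : Set a} → (A → Bool) → List A → List A
filterᵇ p []       = []
filterᵇ p (x ∷ xs) = if p x then x ∷ filterᵇ p xs else filterᵇ p xs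

count : ∀ {a} {A : Set a} → (A → Bool) → List A → ℕ
count p []       = 0
count p (x ∷ xs) = if p x then suc (count p xs) else count p xs

record FiniteField (c ℓ : Level) : Set (Level.suc (c ⊔ ℓ)) where
  field
    commRing : CommutativeRing c ℓ
  open CommutativeRing commRing public
  field
    1≉0      : ¬ (1# ≈ 0#)
    inverse  : ∀ x → ¬ (x ≈ 0#) → ∃[ y ] (x * y ≈ 1#)
    _≟_      : ∀ x y → Dec (x ≈ y)
    elems    : List Carrier
    complete : ∀ x → count (λ y → does (x ≟ y)) elems ≡ 1

  size : ℕ
  size = length elems

  isZero : Carrier → Bool
  isZero x = does (x ≟ 0#)

record FinRingData (a : Level) : Set (Level.suc a) where
  field
    Carrier : Set a
    mul     : Carrier → Carrier → Carrier
    isZero  : Carrier → Bool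
    eq      : Carrier → Carrier → Bool
    elems   : List Carrier

module ZeroDivisorGraph {a} (R : FinRingData a) where
  open FinRingData R

  isZeroDivisor : Carrier → Bool
  isZeroDivisor x = any (λ y → not (isZero y) ∧ isZero (mul x y)) elems

  V : List Carrier
  V = filterᵇ (λ x → not (isZero x) ∧ isZeroDivisor x) elems

  adj : Carrier → Carrier → Bool
  adj u v = not (eq u v) ∧ isZero (mul u v)

  -- subsets S of V are Boolean predicates (only evaluated on V)
  card : (Carrier → Bool) → ℕ
  card S = count S V

  δ : (Carrier → Bool) → Carrier → ℕ
  δ S v = count (λ w → adj v w ∧ S w) V

  complement : (Carrier → Bool) → (Carrier → Bool)
  complement S x = not (S x)

  IsGlobalOffensiveAlliance : (Carrier → Bool) → Set a
  IsGlobalOffensiveAlliance S =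
    (1 ≤ card S) ×
    All (λ v → S v ≡ false → δ (complement S) v + 1 ≤ δ S v) V

  OffensiveAllianceNumberIs : ℕ → Set a
  OffensiveAllianceNumberIs m =
    Σ (Carrier → Bool) (λ S → IsGlobalOffensiveAlliance S × card S ≡ m)
    × (∀ (S : Carrier → Bool) → IsGlobalOffensiveAlliance S → m ≤ card S)

-- The ring Z₂ × K × F.  Z₂ is represented by Bool (true = 1, false = 0),
-- whose multiplication is ∧.
Z2×_×_ : ∀ {c₁ ℓ₁ c₂ ℓ₂} → FiniteField c₁ ℓ₁ → FiniteField c₂ ℓ₂
       → FinRingData (c₁ ⊔ c₂)
Z2× K × F = record
  { Carrier = Bool × K.Carrier × F.Carrier
  ; mul     = λ { (a , b , c) (a' , b' , c') → (a ∧ a' , b K.* b' , c F.* c') }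
  ; isZero  = λ { (a , b , c) → not a ∧ K.isZero b ∧ F.isZero c }
  ; eq      = λ { (a , b , c) (a' , b' , c') →
                  does (a ≟B a') ∧ does (b K.≟ b') ∧ does (c F.≟ c') }
  ; elems   = concatMap (λ a → concatMap (λ b → map (λ c → (a , b , c)) F.elems)
                                         K.elems)
                        (true ∷ false ∷ [])
  }
  where
    module K = FiniteField K
    module F = FiniteField F

γᵒ-formula : ℕ → ℕ → ℕ
γᵒ-formula k f = 1 + ((2 * k) ⊓ (2 * f) ⊓ (f + ⌊ k /2⌋ + 1) ⊓ (k + ⌊ f /2⌋ + 1))
  where open Data.Nat using (_*_)

module Submission where

-- Adjacency of two vertices of Γ(ℤ₂ × K × F) depends only on their supports (the sets of nonzero
-- coordinates): they are adjacent iff their supports are disjoint.  The six possible supports A, B, C,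
-- AB, AC, BC give classes of sizes 1, |K*|, |F*|, |K*|, |F*|, |K*||F*|, so whether S is a global
-- offensive alliance depends only on how many vertices of each class lie inside and outside S: each
-- class lying partly outside S contributes one linear inequality.  If A ⊄ S, the BC-vertices force
-- BC ⊆ S and the A-vertex then forces S to exceed the minimum.  If A ⊆ S, a case split on whether B
-- and C lie in S yields one of the four terms of the minimum, and the sets A∪B∪AB, A∪C∪AC,
-- A∪C∪(majority of B), A∪B∪(majority of C) attain them.  Any class profile is realised by an actual
-- vertex set, since the ring elements are enumerated without repetition.

open import Defs
open import Level using (_⊔_)
open import Algebra.Bundles using (CommutativeMonoid)
open import Data.Bool using (Bool; true; false; not; _∧_; _∨_; if_then_else_)
open import Data.Bool.ListAction using (or; any)
open import Data.Bool.Properties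
  using (∧-identityʳ; ∧-zeroʳ; ∨-zeroʳ; ∧-inverseˡ; ∧-conicalˡ; ∧-conicalʳ; not-involutive; ∨-∧-booleanAlgebra)
  renaming (_≟_ to _≟ᵇ_)
import Data.Bool.Properties as Bool
open import Data.List using (List; []; _∷_; _++_; map; concatMap; length)
open import Data.List.Membership.Propositional using (_∈_)
open import Data.List.Properties using (map-cong)
open import Data.List.Relation.Unary.Any using (here; there)
import Data.List.Relation.Unary.All as All
open import Data.Maybe using (Maybe; just; nothing; is-just; maybe)
open import Data.Nat
  using (ℕ; zero; suc; _+_; _*_; _∸_; _≤_; _<_; _⊓_; ⌊_/2⌋; ⌈_/2⌉; z≤n; s≤s; s≤s⁻¹)
open import Data.Nat.ListAction using (sum)
open import Data.Nat.Properties
  using ( +-suc; +-comm; +-assoc; +-identityʳ; *-identityʳ; +-cancelˡ-≡; m+n∸m≡n; n≢0⇒n>0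
        ; ≤-refl; ≤-reflexive; ≤-trans; ≤-total; n≤1+n; m≤n⇒m≤1+n; n≤0⇒n≡0; m≤m+n; m≤n+m; m+n≤o⇒m≤o
        ; ≰⇒>; ≮⇒≥; <⇒≱; +-monoˡ-≤; +-monoʳ-≤; +-mono-≤; +-monoʳ-<; +-mono-<; *-monoˡ-≤; *-mono-≤
        ; ⊓-sel; ⊓-glb; m⊓n≤m; m⊓n≤n; m≤n⇒m⊓o≤n; ⌊n/2⌋≤⌈n/2⌉; ⌊n/2⌋+⌈n/2⌉≡n
        ; ∸-monoˡ-≤; +-commutativeSemigroup; module ≤-Reasoning )
  renaming (_≟_ to _≟ℕ_)
open import Data.Nat.Tactic.RingSolver using (solve-∀)
open import Data.Product using (_×_; _,_; proj₁; proj₂; ∃-syntax; Σ-syntax)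
open import Data.Product.Relation.Binary.Pointwise.NonDependent using (×-decSetoid)
open import Data.Sum using (_⊎_; inj₁; inj₂)
open import Relation.Binary.Bundles using (DecSetoid)
open import Relation.Binary.Definitions using (DecidableEquality)
open import Relation.Binary.PropositionalEquality
  using (_≡_; refl; sym; trans; cong; cong₂; subst; subst₂; module ≡-Reasoning)
open import Relation.Nullary using (¬_; Dec; does; yes; no; contradiction)
open import Relation.Nullary.Decidable using (dec-true; dec-false; map′; _×-dec_)
open import Algebra.Lattice.Properties.BooleanAlgebra ∨-∧-booleanAlgebra using (deMorgan₁)
open import Algebra.Properties.CommutativeSemigroup +-commutativeSemigroup using (x∙yz≈y∙xz; interchange)
open import Algebra.Properties.CommutativeSemigroup (CommutativeMonoid.commutativeSemigroup Bool.∧-commutativeMonoid)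
  using () renaming (x∙yz≈y∙xz to ∧-x∧yz≈y∧xz)
import Relation.Binary.Reasoning.Setoid as SetoidReasoning

does⇒ : ∀ {p} {P : Set p} (P? : Dec P) → does P? ≡ true → P
does⇒ (yes p) _ = p

module _ {a} {A : Set a} where

  count-cong-∈ : ∀ {p q : A → Bool} xs → (∀ {x} → x ∈ xs → p x ≡ q x) → count p xs ≡ count q xs
  count-cong-∈ []       p≗q = refl
  count-cong-∈ {q = q} (x ∷ xs) p≗q rewrite p≗q (here refl) with q x
  ... | true  = cong suc (count-cong-∈ xs (λ x∈ → p≗q (there x∈)))
  ... | false = count-cong-∈ xs (λ x∈ → p≗q (there x∈))

  count-cong : ∀ {p q : A → Bool} → (∀ x → p x ≡ q x) → ∀ xs → count p xs ≡ count q xs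
  count-cong p≗q xs = count-cong-∈ xs (λ {x} _ → p≗q x)

  count-++ : ∀ (p : A → Bool) xs ys → count p (xs ++ ys) ≡ count p xs + count p ys
  count-++ p []       ys = refl
  count-++ p (x ∷ xs) ys with p x
  ... | true  = cong suc (count-++ p xs ys)
  ... | false = count-++ p xs ys

  count-false : ∀ (xs : List A) → count (λ _ → false) xs ≡ 0
  count-false []       = refl
  count-false (x ∷ xs) = count-false xs

  count-∧ˡ : ∀ b (p : A → Bool) xs → count (λ x → b ∧ p x) xs ≡ (if b then count p xs else 0)
  count-∧ˡ true  p xs = refl
  count-∧ˡ false p xs = count-false xs

  count-∷-≤ : ∀ (p : A → Bool) x xs → count p xs ≤ count p (x ∷ xs)
  count-∷-≤ p x xs with p x
  ... | true  = n≤1+n _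
  ... | false = ≤-refl

  count-∧-split : ∀ (p q : A → Bool) xs →
                  count (λ x → p x ∧ q x) xs + count (λ x → p x ∧ not (q x)) xs ≡ count p xs
  count-∧-split p q []       = refl
  count-∧-split p q (x ∷ xs) with p x | q x
  ... | true  | true  = cong suc (count-∧-split p q xs)
  ... | true  | false = trans (+-suc _ _) (cong suc (count-∧-split p q xs))
  ... | false | _     = count-∧-split p q xs

  count-not : ∀ (p : A → Bool) xs → count p xs + count (λ x → not (p x)) xs ≡ length xs
  count-not p []       = refl
  count-not p (x ∷ xs) with p x
  ... | true  = cong suc (count-not p xs)
  ... | false = trans (+-suc _ _) (cong suc (count-not p xs))

  count-mono : ∀ {p q : A → Bool} → (∀ x → p x ≡ true → q x ≡ true) → ∀ xs → count p xs ≤ count q xs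
  count-mono p⇒q []       = z≤n
  count-mono {p} {q} p⇒q (x ∷ xs) with p x in px
  ... | true rewrite p⇒q x px = s≤s (count-mono p⇒q xs)
  ... | false with q x
  ...   | true  = m≤n⇒m≤1+n (count-mono p⇒q xs)
  ...   | false = count-mono p⇒q xs

  count-≡0 : ∀ {p : A → Bool} {x} xs → count p xs ≡ 0 → x ∈ xs → p x ≡ false
  count-≡0 {p} (y ∷ xs) c≡0 x∈ with p y in py
  count-≡0 {p} (y ∷ xs) () x∈           | true
  count-≡0 {p} (y ∷ xs) c≡0 (here refl) | false = py
  count-≡0 {p} (y ∷ xs) c≡0 (there x∈)  | false = count-≡0 xs c≡0 x∈

  count-witness : ∀ {p : A → Bool} xs → 1 ≤ count p xs → ∃[ x ] x ∈ xs × p x ≡ true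
  count-witness {p} (y ∷ xs) 1≤c with p y in py
  ... | true  = y , here refl , py
  ... | false with count-witness xs 1≤c
  ...   | x , x∈ , px = x , there x∈ , px

  any-true : ∀ {p : A → Bool} {x} xs → x ∈ xs → p x ≡ true → any p xs ≡ true
  any-true {p} (y ∷ xs) (here refl) px rewrite px = refl
  any-true {p} (y ∷ xs) (there x∈)  px = trans (cong (p y ∨_) (any-true xs x∈ px)) (∨-zeroʳ (p y))

  any-false : ∀ {p : A → Bool} → (∀ x → p x ≡ false) → ∀ xs → any p xs ≡ false
  any-false p≡false []       = refl
  any-false p≡false (x ∷ xs) rewrite p≡false x = any-false p≡false xs

  count-filterᵇ : ∀ (p q : A → Bool) xs → count p (filterᵇ q xs) ≡ count (λ x → q x ∧ p x) xs
  count-filterᵇ p q []       = refl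
  count-filterᵇ p q (x ∷ xs) with q x
  ... | false = count-filterᵇ p q xs
  ... | true with p x
  ...   | true  = cong suc (count-filterᵇ p q xs)
  ...   | false = count-filterᵇ p q xs

  filterᵇ-cong : ∀ {p q : A → Bool} → (∀ x → p x ≡ q x) → ∀ xs → filterᵇ p xs ≡ filterᵇ q xs
  filterᵇ-cong p≗q []       = refl
  filterᵇ-cong {q = q} p≗q (x ∷ xs) rewrite p≗q x with q x
  ... | true  = cong (x ∷_) (filterᵇ-cong p≗q xs)
  ... | false = filterᵇ-cong p≗q xs

  ∈-filterᵇ⁺ : ∀ {q : A → Bool} {x} xs → x ∈ xs → q x ≡ true → x ∈ filterᵇ q xs
  ∈-filterᵇ⁺ {q} (y ∷ xs) (here refl) qx rewrite qx = here refl
  ∈-filterᵇ⁺ {q} (y ∷ xs) (there x∈)  qx with q y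
  ... | true  = there (∈-filterᵇ⁺ xs x∈ qx)
  ... | false = ∈-filterᵇ⁺ xs x∈ qx

  ∈-filterᵇ⁻ : ∀ {q : A → Bool} {x} xs → x ∈ filterᵇ q xs → x ∈ xs × q x ≡ true
  ∈-filterᵇ⁻ {q} (y ∷ xs) x∈ with q y in qy
  ∈-filterᵇ⁻ {q} (y ∷ xs) (here refl) | true = here refl , qy
  ∈-filterᵇ⁻ {q} (y ∷ xs) (there x∈)  | true with ∈-filterᵇ⁻ xs x∈
  ...   | x∈xs , qx = there x∈xs , qx
  ∈-filterᵇ⁻ {q} (y ∷ xs) x∈ | false with ∈-filterᵇ⁻ xs x∈
  ...   | x∈xs , qx = there x∈xs , qx

sum-map-0 : ∀ {b} {B : Set b} (js : List B) → sum (map (λ _ → 0) js) ≡ 0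
sum-map-0 []       = refl
sum-map-0 (_ ∷ js) = sum-map-0 js

sum-map-suc-if : ∀ {b} {B : Set b} (q : B → Bool) (c : B → ℕ) js →
                 sum (map (λ i → if q i then suc (c i) else c i) js) ≡ count q js + sum (map c js)
sum-map-suc-if q c []       = refl
sum-map-suc-if q c (j ∷ js) with q j
... | true  = cong suc (trans (cong (c j +_) (sum-map-suc-if q c js)) (x∙yz≈y∙xz (c j) (count q js) (sum (map c js))))
... | false = trans (cong (c j +_) (sum-map-suc-if q c js)) (x∙yz≈y∙xz (c j) (count q js) (sum (map c js)))

module _ {a b} {A : Set a} {B : Set b} where

  count-map : ∀ (p : B → Bool) (h : A → B) xs → count p (map h xs) ≡ count (λ x → p (h x)) xs
  count-map p h []       = refl
  count-map p h (x ∷ xs) with p (h x)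
  ... | true  = cong suc (count-map p h xs)
  ... | false = count-map p h xs

  count-concatMap : ∀ (p : B → Bool) (g : A → List B) (q : A → Bool) n →
                    (∀ x → count p (g x) ≡ (if q x then n else 0)) →
                    ∀ xs → count p (concatMap g xs) ≡ count q xs * n
  count-concatMap p g q n cg []       = refl
  count-concatMap p g q n cg (x ∷ xs)
    rewrite count-++ p (g x) (concatMap g xs) | cg x | count-concatMap p g q n cg xs with q x
  ... | true  = refl
  ... | false = refl

  count-partition : ∀ (p : A → Bool) (member : A → B → Bool) (is : List B) xs →
                    (∀ {x} → x ∈ xs → count (member x) is ≡ 1) →
                    count p xs ≡ sum (map (λ i → count (λ x → member x i ∧ p x) xs) is)
  count-partition p member is []       once = sym (sum-map-0 is)
  count-partition p member is (x ∷ xs) once with p x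
  ... | true  = begin
    suc (count p xs)                                        ≡⟨ cong₂ _+_ (sym (once (here refl))) IH ⟩
    count (member x) is + sum (map inClass is)              ≡⟨ cong (_+ sum (map inClass is))
                                                                    (count-cong (λ i → sym (∧-identityʳ (member x i))) is) ⟩
    count (λ i → member x i ∧ true) is + sum (map inClass is) ≡⟨ sym (sum-map-suc-if _ inClass is) ⟩
    sum (map (λ i → if member x i ∧ true then suc (inClass i) else inClass i) is) ∎
    where
      open ≡-Reasoning
      inClass : B → ℕ
      inClass i = count (λ y → member y i ∧ p y) xs
      IH : count p xs ≡ sum (map inClass is)
      IH = count-partition p member is xs (λ x∈ → once (there x∈))
  ... | false = trans (count-partition p member is xs (λ x∈ → once (there x∈)))
                      (cong sum (map-cong (λ i → sym (if-false (member x i))) is))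
    where
      if-false : ∀ c {m n : ℕ} → (if c ∧ false then m else n) ≡ n
      if-false c rewrite ∧-zeroʳ c = refl

module _ {c ℓ} (D : DecSetoid c ℓ) where
  open DecSetoid D using (Carrier; _≟_) renaming (refl to ≈-refl; sym to ≈-sym)

  Distinct : List Carrier → Set c
  Distinct xs = ∀ x → count (λ y → does (x ≟ y)) xs ≤ 1

  distinct-tail : ∀ {y ys} → Distinct (y ∷ ys) → Distinct ys
  distinct-tail {y} {ys} distinct x = ≤-trans (count-∷-≤ (λ z → does (x ≟ z)) y ys) (distinct x)

  distinct-head : ∀ {y ys} → Distinct (y ∷ ys) → ∀ {x} → x ∈ ys → does (x ≟ y) ≡ false
  distinct-head {y} {ys} distinct {x} x∈ = dec-false (x ≟ y) (λ x≈y →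
    contradiction (trans (sym (dec-true (y ≟ x) (≈-sym x≈y))) (count-≡0 ys y∉ys x∈)) λ ())
    where
      y∉ys : count (λ z → does (y ≟ z)) ys ≡ 0
      y∉ys with distinct y
      ... | c≤1 rewrite dec-true (y ≟ y) ≈-refl = n≤0⇒n≡0 (s≤s⁻¹ c≤1)

  select : ∀ (p : Carrier → Bool) xs → Distinct xs →
           ∀ {m} → m ≤ count p xs → Σ[ q ∈ (Carrier → Bool) ] count (λ x → p x ∧ q x) xs ≡ m
  select p []       distinct z≤n = (λ _ → false) , refl
  select p (y ∷ ys) distinct {m} m≤ with p y in py
  ... | false = select p ys (distinct-tail {y} {ys} distinct) m≤
  select p (y ∷ ys) distinct {zero}  m≤       | true =
    (λ _ → false) , trans (count-cong (λ x → ∧-zeroʳ (p x)) ys) (count-false ys)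
  select p (y ∷ ys) distinct {suc m} (s≤s m≤) | true with select p ys (distinct-tail {y} {ys} distinct) m≤
  ... | q , pq≡m = (λ x → does (x ≟ y) ∨ q x) , count-with-head (dec-true (y ≟ y) ≈-refl)
    where
      rest : ℕ
      rest = count (λ x → p x ∧ (does (x ≟ y) ∨ q x)) ys
      count-with-head : ∀ {b} → b ≡ true → (if b ∨ q y then suc rest else rest) ≡ suc m
      count-with-head refl = cong suc (trans
        (count-cong-∈ ys (λ {x} x∈ → cong (λ b → p x ∧ (b ∨ q x)) (distinct-head distinct x∈))) pq≡m)

does-≟ᵇ-true : ∀ b → does (b ≟ᵇ true) ≡ b
does-≟ᵇ-true true  = refl
does-≟ᵇ-true false = refl

does-≟ᵇ-false : ∀ b → does (b ≟ᵇ false) ≡ not b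
does-≟ᵇ-false true  = refl
does-≟ᵇ-false false = refl

module FiniteFieldProperties {c ℓ} (K : FiniteField c ℓ) where
  open FiniteField K hiding (_+_; _*_; refl; sym; trans)
  open FiniteField K using () renaming (_*_ to _·_)
  open FiniteField K using () renaming (refl to ≈-refl; sym to ≈-sym; trans to ≈-trans)

  decSetoid : DecSetoid c ℓ
  decSetoid = record { isDecEquivalence = record { isEquivalence = isEquivalence ; _≟_ = _≟_ } }

  does-≟-sym : ∀ x y → does (x ≟ y) ≡ does (y ≟ x)
  does-≟-sym x y with y ≟ x
  ... | yes y≈x = dec-true (x ≟ y) (≈-sym y≈x)
  ... | no  y≉x = dec-false (x ≟ y) (λ x≈y → y≉x (≈-sym x≈y))

  isZero-resp-≈ : ∀ {x y} → x ≈ y → isZero x ≡ isZero y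
  isZero-resp-≈ {x} {y} x≈y with x ≟ 0#
  ... | yes x≈0 = sym (dec-true (y ≟ 0#) (≈-trans (≈-sym x≈y) x≈0))
  ... | no  x≉0 = sym (dec-false (y ≟ 0#) (λ y≈0 → x≉0 (≈-trans x≈y y≈0)))

  x≉0∧xy≈0⇒y≈0 : ∀ {x y} → ¬ x ≈ 0# → x · y ≈ 0# → y ≈ 0#
  x≉0∧xy≈0⇒y≈0 {x} {y} x≉0 xy≈0 with inverse x x≉0
  ... | x⁻¹ , xx⁻¹≈1 = begin
    y              ≈⟨ ≈-sym (*-identityˡ y) ⟩
    1# · y         ≈⟨ *-cong (≈-sym xx⁻¹≈1) ≈-refl ⟩
    (x · x⁻¹) · y  ≈⟨ *-cong (*-comm x x⁻¹) ≈-refl ⟩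
    (x⁻¹ · x) · y  ≈⟨ *-assoc x⁻¹ x y ⟩
    x⁻¹ · (x · y)  ≈⟨ *-cong ≈-refl xy≈0 ⟩
    x⁻¹ · 0#       ≈⟨ zeroʳ x⁻¹ ⟩
    0#             ∎
    where open SetoidReasoning setoid

  isZero-* : ∀ x y → isZero (x · y) ≡ isZero x ∨ isZero y
  isZero-* x y with x ≟ 0# | y ≟ 0#
  ... | yes x≈0 | _       = dec-true ((x · y) ≟ 0#) (≈-trans (*-cong x≈0 ≈-refl) (zeroˡ y))
  ... | no  _   | yes y≈0 = dec-true ((x · y) ≟ 0#) (≈-trans (*-cong ≈-refl y≈0) (zeroʳ x))
  ... | no  x≉0 | no  y≉0 = dec-false ((x · y) ≟ 0#) (λ xy≈0 → y≉0 (x≉0∧xy≈0⇒y≈0 x≉0 xy≈0))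

  count-isZero : count isZero elems ≡ 1
  count-isZero = trans (count-cong (λ y → does-≟-sym y 0#) elems) (complete 0#)

  count-nonzero : count (λ x → not (isZero x)) elems ≡ size ∸ 1
  count-nonzero = trans (sym (m+n∸m≡n 1 _)) (cong (_∸ 1) (trans
    (cong (_+ count (λ x → not (isZero x)) elems) (sym count-isZero)) (count-not isZero elems)))

  1≤size∸1 : 1 ≤ size ∸ 1
  1≤size∸1 = ≤-trans (≤-reflexive (sym (complete 1#)))
                     (≤-trans (count-mono 1≈⇒nonzero elems) (≤-reflexive count-nonzero))
    where
      1≈⇒nonzero : ∀ y → does (1# ≟ y) ≡ true → not (isZero y) ≡ true
      1≈⇒nonzero y 1≈y = cong not (dec-false (y ≟ 0#) (λ y≈0 → 1≉0 (≈-trans (does⇒ (1# ≟ y) 1≈y) y≈0)))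

  count-nonzero-is : ∀ b → count (λ x → does (not (isZero x) ≟ᵇ b)) elems ≡ (if b then size ∸ 1 else 1)
  count-nonzero-is true  = trans (count-cong (λ x → does-≟ᵇ-true (not (isZero x))) elems) count-nonzero
  count-nonzero-is false = trans (count-cong (λ x → trans (does-≟ᵇ-false (not (isZero x))) (not-involutive (isZero x))) elems)
                                 count-isZero

-- The vertex classes of Γ(ℤ₂ × K × F), named by the nonzero coordinates of their members.
data VClass : Set where
  A B C AB AC BC : VClass

vertexClasses : List VClass
vertexClasses = A ∷ B ∷ C ∷ AB ∷ AC ∷ BC ∷ []

Σᵥ : (VClass → ℕ) → ℕ
Σᵥ N = sum (map N vertexClasses)

Σᵥ-cong : ∀ {M N : VClass → ℕ} → (∀ t → M t ≡ N t) → Σᵥ M ≡ Σᵥ N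
Σᵥ-cong M≗N = cong sum (map-cong M≗N vertexClasses)

-- sizes of the classes when k = |K*| and f = |F*|
classSize : ℕ → ℕ → VClass → ℕ
classSize k f A  = 1
classSize k f B  = k
classSize k f C  = f
classSize k f AB = k
classSize k f AC = f
classSize k f BC = k * f

-- N summed over the classes whose supports are disjoint from that of u
nbr : (VClass → ℕ) → VClass → ℕ
nbr N A  = N B + (N C + N BC)
nbr N B  = N A + (N C + N AC)
nbr N C  = N A + (N B + N AB)
nbr N AB = N C
nbr N AC = N B
nbr N BC = N A

nbr-cong : ∀ {M N : VClass → ℕ} → (∀ t → M t ≡ N t) → ∀ u → nbr M u ≡ nbr N u
nbr-cong M≗N A  = cong₂ _+_ (M≗N B) (cong₂ _+_ (M≗N C) (M≗N BC))
nbr-cong M≗N B  = cong₂ _+_ (M≗N A) (cong₂ _+_ (M≗N C) (M≗N AC))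
nbr-cong M≗N C  = cong₂ _+_ (M≗N A) (cong₂ _+_ (M≗N B) (M≗N AB))
nbr-cong M≗N AB = M≗N C
nbr-cong M≗N AC = M≗N B
nbr-cong M≗N BC = M≗N A

record Split (k f : ℕ) : Set where
  field
    inside outside : VClass → ℕ
    partition      : ∀ t → inside t + outside t ≡ classSize k f t

Offensive : ∀ {k f} → Split k f → Set
Offensive P = ∀ t → outside t ≡ 0 ⊎ nbr outside t < nbr inside t
  where open Split P

offensive-resp : ∀ {k f} (P Q : Split k f) → (∀ t → Split.inside P t ≡ Split.inside Q t) →
                 (∀ t → Split.outside P t ≡ Split.outside Q t) → Offensive P → Offensive Q
offensive-resp P Q in≗ out≗ offensive t with offensive t
... | inj₁ out≡0 = inj₁ (trans (sym (out≗ t)) out≡0)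
... | inj₂ nbr<  = inj₂ (subst₂ _<_ (nbr-cong out≗ t) (nbr-cong in≗ t) nbr<)

γᵒ-min : ℕ → ℕ → ℕ
γᵒ-min k f = (2 * k) ⊓ (2 * f) ⊓ (f + ⌊ k /2⌋ + 1) ⊓ (k + ⌊ f /2⌋ + 1)

γᵒ-min≤2k : ∀ k f → γᵒ-min k f ≤ 2 * k
γᵒ-min≤2k k f = m≤n⇒m⊓o≤n _ (m≤n⇒m⊓o≤n _ (m⊓n≤m _ _))

γᵒ-min≤2f : ∀ k f → γᵒ-min k f ≤ 2 * f
γᵒ-min≤2f k f = m≤n⇒m⊓o≤n _ (m≤n⇒m⊓o≤n _ (m⊓n≤n _ _))

γᵒ-min≤f+⌊k/2⌋+1 : ∀ k f → γᵒ-min k f ≤ f + ⌊ k /2⌋ + 1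
γᵒ-min≤f+⌊k/2⌋+1 k f = m≤n⇒m⊓o≤n _ (m⊓n≤n _ _)

γᵒ-min≤k+⌊f/2⌋+1 : ∀ k f → γᵒ-min k f ≤ k + ⌊ f /2⌋ + 1
γᵒ-min≤k+⌊f/2⌋+1 k f = m⊓n≤n _ _

γᵒ-min≤k+f : ∀ k f → γᵒ-min k f ≤ k + f
γᵒ-min≤k+f k f with ≤-total k f
... | inj₁ k≤f = ≤-trans (γᵒ-min≤2k k f) (+-monoʳ-≤ k (≤-trans (≤-reflexive (+-identityʳ k)) k≤f))
... | inj₂ f≤k = ≤-trans (γᵒ-min≤2f k f)
                   (≤-trans (+-monoʳ-≤ f (≤-trans (≤-reflexive (+-identityʳ f)) f≤k)) (≤-reflexive (+-comm f k)))

γᵒ-min≤k*f : ∀ {k f} → 1 ≤ k → 2 ≤ f → γᵒ-min k f ≤ k * f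
γᵒ-min≤k*f {1}           {f} _ 2≤f = ≤-trans (γᵒ-min≤2k 1 f) (≤-trans 2≤f (≤-reflexive (sym (+-identityʳ f))))
γᵒ-min≤k*f {suc (suc k)} {f} _ _   = ≤-trans (γᵒ-min≤2f _ f) (*-monoˡ-≤ f {2} {suc (suc k)} (s≤s (s≤s z≤n)))

half-bound : ∀ {n m t} → n + m ≡ t → m < n → ⌊ t /2⌋ < n
half-bound {n} {m} refl m<n = ≰⇒> λ n≤⌊t/2⌋ → <⇒≱ (+-monoʳ-< n m<n) (begin
  n + n                      ≤⟨ +-mono-≤ n≤⌊t/2⌋ (≤-trans n≤⌊t/2⌋ (⌊n/2⌋≤⌈n/2⌉ (n + m))) ⟩
  ⌊ n + m /2⌋ + ⌈ n + m /2⌉  ≡⟨ ⌊n/2⌋+⌈n/2⌉≡n (n + m) ⟩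
  n + m                      ∎)
  where open ≤-Reasoning

pair-bound : ∀ {n₁ m₁ n₂ m₂ t} → n₁ + m₁ ≡ t → n₂ + m₂ ≡ t → m₁ + m₂ ≤ n₁ + n₂ → t ≤ n₁ + n₂
pair-bound {n₁} {m₁} {n₂} {m₂} refl n₂+m₂≡t m≤n = ≮⇒≥ λ s<t → <⇒≱ (+-mono-< s<t s<t) (begin
  (n₁ + m₁) + (n₁ + m₁)  ≡⟨ cong ((n₁ + m₁) +_) (sym n₂+m₂≡t) ⟩
  (n₁ + m₁) + (n₂ + m₂)  ≡⟨ interchange n₁ m₁ n₂ m₂ ⟩
  (n₁ + n₂) + (m₁ + m₂)  ≤⟨ +-monoʳ-≤ (n₁ + n₂) m≤n ⟩
  (n₁ + n₂) + (n₁ + n₂)  ∎)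
  where open ≤-Reasoning

-- nX and mX count the X-vertices inside and outside S.
-- A ⊄ S: the A-vertex outside S is adjacent to all of B, C and BC.
bound-without-A : ∀ {k f nB mB nC mC nBC mBC} → 1 ≤ k → 2 ≤ f →
                  nB + mB ≡ k → nC + mC ≡ f → nBC + mBC ≡ k * f → mBC ≡ 0 →
                  mB + (mC + mBC) < nB + (nC + nBC) → suc (γᵒ-min k f) ≤ nB + (nC + nBC)
bound-without-A {k} {f} {zero} {nC = zero} {mC} _ _ refl refl _ refl A-ok =
  ≤-trans (s≤s (≤-trans (γᵒ-min≤k+f k f) (≤-reflexive (cong (k +_) (sym (+-identityʳ mC)))))) A-ok
bound-without-A {nB = suc nB} {nC = nC} {nBC = nBC} 1≤k 2≤f _ _ nBC+0≡kf refl _ =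
  s≤s (≤-trans (γᵒ-min≤k*f 1≤k 2≤f) (≤-trans (≤-reflexive (trans (sym nBC+0≡kf) (+-identityʳ nBC)))
                                       (≤-trans (m≤n+m nBC nC) (m≤n+m (nC + nBC) nB))))
bound-without-A {nB = zero} {nC = suc nC} {nBC = nBC} 1≤k 2≤f _ _ nBC+0≡kf refl _ =
  s≤s (≤-trans (γᵒ-min≤k*f 1≤k 2≤f) (≤-trans (≤-reflexive (trans (sym nBC+0≡kf) (+-identityʳ nBC))) (m≤n+m nBC nC)))

-- X ⊆ S, and an XY-vertex outside S is adjacent to the class Z only.
bound-class-inside : ∀ {x z nX nXY mXY nZ mZ} → nX ≡ x → nXY + mXY ≡ x → nZ + mZ ≡ z →
                     (mXY ≡ 0 ⊎ mZ < nZ) → (2 * x) ⊓ (x + ⌊ z /2⌋ + 1) ≤ nX + nXY + nZ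
bound-class-inside {nX = nX} {nXY} {nZ = nZ} refl nXY+0≡x _ (inj₁ refl) = begin
  (2 * nX) ⊓ _    ≤⟨ m⊓n≤m _ _ ⟩
  nX + (nX + 0)   ≡⟨ cong (nX +_) (trans (+-identityʳ nX) (sym nXY+0≡x)) ⟩
  nX + (nXY + 0)  ≡⟨ cong (nX +_) (+-identityʳ nXY) ⟩
  nX + nXY        ≤⟨ m≤m+n (nX + nXY) nZ ⟩
  nX + nXY + nZ   ∎
  where open ≤-Reasoning
bound-class-inside {z = z} {nX} {nXY} {nZ = nZ} refl _ nZ+mZ≡z (inj₂ mZ<nZ) = begin
  _ ⊓ (nX + ⌊ z /2⌋ + 1)  ≤⟨ m⊓n≤n _ _ ⟩
  nX + ⌊ z /2⌋ + 1        ≡⟨ trans (+-assoc nX _ 1) (cong (nX +_) (+-comm _ 1)) ⟩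
  nX + suc ⌊ z /2⌋        ≤⟨ +-monoʳ-≤ nX (half-bound nZ+mZ≡z mZ<nZ) ⟩
  nX + nZ                 ≤⟨ +-monoˡ-≤ nZ (m≤m+n nX nXY) ⟩
  nX + nXY + nZ           ∎
  where open ≤-Reasoning

-- A ⊆ S: the conditions at B, C, AB, AC bound |S ∩ (B ∪ AB ∪ C ∪ AC)|.
bound-with-A : ∀ {k f nB mB nC mC nAB mAB nAC mAC} →
               nB + mB ≡ k → nC + mC ≡ f → nAB + mAB ≡ k → nAC + mAC ≡ f →
               (mB ≡ 0 ⊎ mC + mAC < suc (nC + nAC)) → (mC ≡ 0 ⊎ mB + mAB < suc (nB + nAB)) →
               (mAB ≡ 0 ⊎ mC < nC) → (mAC ≡ 0 ⊎ mB < nB) →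
               γᵒ-min k f ≤ nB + nAB + (nC + nAC)
bound-with-A {k} {f} {nB} {zero} {nC} {zero} refl refl _ _ _ _ _ _ =
  ≤-trans (γᵒ-min≤k+f k f) (+-mono-≤ (+-monoʳ-≤ nB z≤n) (+-monoʳ-≤ nC z≤n))
bound-with-A {k} {f} {nB} {zero} {nC} {suc _} {nAB} {nAC = nAC} nB+0≡k nC+mC≡f nAB+mAB≡k _ _ _ AB-ok _ =
  ≤-trans (⊓-glb (γᵒ-min≤2k k f) (γᵒ-min≤k+⌊f/2⌋+1 k f))
    (≤-trans (bound-class-inside (trans (sym (+-identityʳ nB)) nB+0≡k) nAB+mAB≡k nC+mC≡f AB-ok)
             (+-monoʳ-≤ (nB + nAB) (m≤m+n nC nAC)))
bound-with-A {k} {f} {nB} {suc _} {nC} {zero} {nAB} {nAC = nAC} nB+mB≡k nC+0≡f _ nAC+mAC≡f _ _ _ AC-ok =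
  ≤-trans (⊓-glb (γᵒ-min≤2f k f) (γᵒ-min≤f+⌊k/2⌋+1 k f))
    (≤-trans (bound-class-inside (trans (sym (+-identityʳ nC)) nC+0≡f) nAC+mAC≡f nB+mB≡k AC-ok)
             (≤-trans (≤-reflexive (+-comm (nC + nAC) nB)) (+-monoˡ-≤ (nC + nAC) (m≤m+n nB nAB))))
bound-with-A {k} {f} {nB} {suc mB} {nC} {suc mC} {nAB} {mAB} {nAC} {mAC} nB+mB≡k nC+mC≡f nAB+mAB≡k nAC+mAC≡f
             (inj₂ B-ok) (inj₂ C-ok) _ _ =
  ≤-trans (γᵒ-min≤k+f k f) (+-mono-≤ (pair-bound {nB} {suc mB} {nAB} {mAB} nB+mB≡k nAB+mAB≡k (s≤s⁻¹ C-ok))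
                                     (pair-bound {nC} {suc mC} {nAC} {mAC} nC+mC≡f nAC+mAC≡f (s≤s⁻¹ B-ok)))

lower-bound : ∀ {k f} → 1 ≤ k → 2 ≤ f → (P : Split k f) → Offensive P → γᵒ-formula k f ≤ Σᵥ (Split.inside P)
lower-bound {k} {f} 1≤k 2≤f P offensive
  with inside A | outside A | partition A | offensive A | offensive B | offensive C | offensive AB | offensive AC | offensive BC
  where open Split P
... | zero | _ | refl | inj₁ () | _ | _ | _ | _ | _
... | zero | _ | refl | inj₂ _ | _ | _ | _ | _ | inj₂ ()
... | zero | _ | refl | inj₂ A-ok | _ | _ | _ | _ | inj₁ mBC≡0 =
  ≤-trans (bound-without-A {nB = inside B} {outside B} {inside C} {outside C} 1≤k 2≤f
                           (partition B) (partition C) (partition BC) mBC≡0 A-ok)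
          (m+n≤o⇒m≤o (inside B + (inside C + inside BC))
            (≤-reflexive (rearrange (inside B) (inside C) (inside AB) (inside AC) (inside BC))))
  where
    open Split P
    rearrange : ∀ b c ab ac bc → b + (c + bc) + (ab + ac) ≡ b + (c + (ab + (ac + (bc + 0))))
    rearrange = solve-∀
... | suc zero | _ | refl | _ | B-ok | C-ok | AB-ok | AC-ok | _ =
  s≤s (≤-trans (bound-with-A {nB = inside B} {outside B} {inside C} {outside C}
                             {inside AB} {outside AB} {inside AC} {outside AC}
                             (partition B) (partition C) (partition AB) (partition AC) B-ok C-ok AB-ok AC-ok)
               (m+n≤o⇒m≤o (inside B + inside AB + (inside C + inside AC))
                 (≤-reflexive (rearrange (inside B) (inside C) (inside AB) (inside AC) (inside BC)))))
  where
    open Split P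
    rearrange : ∀ b c ab ac bc → b + ab + (c + ac) + bc ≡ b + (c + (ab + (ac + (bc + 0))))
    rearrange = solve-∀

Attains : ℕ → ℕ → ℕ → Set
Attains k f n = Σ[ P ∈ Split k f ] Offensive P × Σᵥ (Split.inside P) ≡ suc n

attains-⊓ : ∀ {k f m n} → Attains k f m → Attains k f n → Attains k f (m ⊓ n)
attains-⊓ {m = m} {n} attains-m attains-n with ⊓-sel m n
... | inj₁ m⊓n≡m rewrite m⊓n≡m = attains-m
... | inj₂ m⊓n≡n rewrite m⊓n≡n = attains-n

-- S = A ∪ B ∪ AB
attains-2k : ∀ {k} f → 1 ≤ k → Attains k f (2 * k)
attains-2k {k} f 1≤k = P , offensive , refl
  where
    P : Split k f
    P = record
      { inside    = λ { A → 1 ; B → k ; C → 0 ; AB → k ; AC → 0 ; BC → 0 }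
      ; outside   = λ { A → 0 ; B → 0 ; C → f ; AB → 0 ; AC → f ; BC → k * f }
      ; partition = λ { A → refl ; B → +-identityʳ k ; C → refl ; AB → +-identityʳ k ; AC → refl ; BC → refl }
      }
    offensive : Offensive P
    offensive A  = inj₁ refl
    offensive B  = inj₁ refl
    offensive C  = inj₂ (s≤s z≤n)
    offensive AB = inj₁ refl
    offensive AC = inj₂ 1≤k
    offensive BC = inj₂ (s≤s z≤n)

-- S = A ∪ C ∪ AC
attains-2f : ∀ k {f} → 1 ≤ f → Attains k f (2 * f)
attains-2f k {f} 1≤f = P , offensive , refl
  where
    P : Split k f
    P = record
      { inside    = λ { A → 1 ; B → 0 ; C → f ; AB → 0 ; AC → f ; BC → 0 }
      ; outside   = λ { A → 0 ; B → k ; C → 0 ; AB → k ; AC → 0 ; BC → k * f }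
      ; partition = λ { A → refl ; B → refl ; C → +-identityʳ f ; AB → refl ; AC → +-identityʳ f ; BC → refl }
      }
    offensive : Offensive P
    offensive A  = inj₁ refl
    offensive B  = inj₂ (s≤s z≤n)
    offensive C  = inj₁ refl
    offensive AB = inj₂ 1≤f
    offensive AC = inj₁ refl
    offensive BC = inj₂ (s≤s z≤n)

-- S = A ∪ C ∪ (⌊k/2⌋ + 1 vertices of B)
attains-f+⌊k/2⌋+1 : ∀ {k f} → 1 ≤ k → 1 ≤ f → Attains k f (f + ⌊ k /2⌋ + 1)
attains-f+⌊k/2⌋+1 {suc j} {f} _ 1≤f = P , offensive , cong suc (rearrange ⌈ j /2⌉ f)
  where
    P : Split (suc j) f
    P = record
      { inside    = λ { A → 1 ; B → suc ⌈ j /2⌉ ; C → f ; AB → 0 ; AC → 0 ; BC → 0 }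
      ; outside   = λ { A → 0 ; B → ⌊ j /2⌋ ; C → 0 ; AB → suc j ; AC → f ; BC → suc j * f }
      ; partition = λ { A → refl ; B → cong suc (trans (+-comm ⌈ j /2⌉ ⌊ j /2⌋) (⌊n/2⌋+⌈n/2⌉≡n j))
                      ; C → +-identityʳ f ; AB → refl ; AC → refl ; BC → refl }
      }
    offensive : Offensive P
    offensive A  = inj₁ refl
    offensive B  = inj₂ (s≤s (≤-reflexive (sym (+-identityʳ f))))
    offensive C  = inj₁ refl
    offensive AB = inj₂ 1≤f
    offensive AC = inj₂ (s≤s (⌊n/2⌋≤⌈n/2⌉ j))
    offensive BC = inj₂ (s≤s z≤n)
    rearrange : ∀ h f → suc h + (f + 0) ≡ f + h + 1
    rearrange = solve-∀

-- S = A ∪ B ∪ (⌊f/2⌋ + 1 vertices of C)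
attains-k+⌊f/2⌋+1 : ∀ {k f} → 1 ≤ k → 1 ≤ f → Attains k f (k + ⌊ f /2⌋ + 1)
attains-k+⌊f/2⌋+1 {k} {suc g} 1≤k _ = P , offensive , cong suc (rearrange k ⌈ g /2⌉)
  where
    P : Split k (suc g)
    P = record
      { inside    = λ { A → 1 ; B → k ; C → suc ⌈ g /2⌉ ; AB → 0 ; AC → 0 ; BC → 0 }
      ; outside   = λ { A → 0 ; B → 0 ; C → ⌊ g /2⌋ ; AB → k ; AC → suc g ; BC → k * suc g }
      ; partition = λ { A → refl ; B → +-identityʳ k ; C → cong suc (trans (+-comm ⌈ g /2⌉ ⌊ g /2⌋) (⌊n/2⌋+⌈n/2⌉≡n g))
                      ; AB → refl ; AC → refl ; BC → refl }
      }
    offensive : Offensive P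
    offensive A  = inj₁ refl
    offensive B  = inj₁ refl
    offensive C  = inj₂ (s≤s (≤-reflexive (sym (+-identityʳ k))))
    offensive AB = inj₂ (s≤s (⌊n/2⌋≤⌈n/2⌉ g))
    offensive AC = inj₂ 1≤k
    offensive BC = inj₂ (s≤s z≤n)
    rearrange : ∀ k h → k + (suc h + 0) ≡ k + h + 1
    rearrange = solve-∀

attains-γᵒ-min : ∀ {k f} → 1 ≤ k → 1 ≤ f → Attains k f (γᵒ-min k f)
attains-γᵒ-min {k} {f} 1≤k 1≤f =
  attains-⊓ (attains-⊓ (attains-⊓ (attains-2k f 1≤k) (attains-2f k 1≤f)) (attains-f+⌊k/2⌋+1 1≤k 1≤f))
            (attains-k+⌊f/2⌋+1 1≤k 1≤f)

-- which of the three coordinates of ℤ₂ × K × F are nonzero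
Support : Set
Support = Bool × Bool × Bool

_≟ˢ_ : DecidableEquality Support
(a , b , c) ≟ˢ (a′ , b′ , c′) =
  map′ (λ (a≡ , b≡ , c≡) → cong₂ _,_ a≡ (cong₂ _,_ b≡ c≡)) (λ { refl → refl , refl , refl })
       (a ≟ᵇ a′ ×-dec b ≟ᵇ b′ ×-dec c ≟ᵇ c′)

disjoint : Support → Support → Bool
disjoint (a , b , c) (a′ , b′ , c′) = not (a ∧ a′) ∧ (not (b ∧ b′) ∧ not (c ∧ c′))

isEmpty isFull : Support → Bool
isEmpty (a , b , c) = not a ∧ (not b ∧ not c)
isFull  (a , b , c) = a ∧ (b ∧ c)

complementˢ : Support → Support
complementˢ (a , b , c) = not a , not b , not c

support : VClass → Support
support A  = true  , false , false
support B  = false , true  , false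
support C  = false , false , true
support AB = true  , true  , false
support AC = true  , false , true
support BC = false , true  , true

classOf : Support → Maybe VClass
classOf (true  , false , false) = just A
classOf (false , true  , false) = just B
classOf (false , false , true ) = just C
classOf (true  , true  , false) = just AB
classOf (true  , false , true ) = just AC
classOf (false , true  , true ) = just BC
classOf (false , false , false) = nothing
classOf (true  , true  , true ) = nothing

isVertex : Support → Bool
isVertex s = is-just (classOf s)

classOf-support : ∀ t → classOf (support t) ≡ just t
classOf-support A  = refl
classOf-support B  = refl
classOf-support C  = refl
classOf-support AB = refl
classOf-support AC = refl
classOf-support BC = refl

isVertex-support : ∀ t → isVertex (support t) ≡ true
isVertex-support t rewrite classOf-support t = refl

isVertex⇒support : ∀ s → isVertex s ≡ true → ∃[ t ] s ≡ support t
isVertex⇒support (true  , false , false) _ = A  , refl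
isVertex⇒support (false , true  , false) _ = B  , refl
isVertex⇒support (false , false , true ) _ = C  , refl
isVertex⇒support (true  , true  , false) _ = AB , refl
isVertex⇒support (true  , false , true ) _ = AC , refl
isVertex⇒support (false , true  , true ) _ = BC , refl

isVertex≡ : ∀ s → isVertex s ≡ not (isEmpty s) ∧ not (isFull s)
isVertex≡ (true  , true  , true ) = refl
isVertex≡ (true  , true  , false) = refl
isVertex≡ (true  , false , true ) = refl
isVertex≡ (true  , false , false) = refl
isVertex≡ (false , true  , true ) = refl
isVertex≡ (false , true  , false) = refl
isVertex≡ (false , false , true ) = refl
isVertex≡ (false , false , false) = refl

class-unique : ∀ s → isVertex s ≡ true → count (λ t → does (s ≟ˢ support t)) vertexClasses ≡ 1
class-unique (true  , false , false) _ = refl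
class-unique (false , true  , false) _ = refl
class-unique (false , false , true ) _ = refl
class-unique (true  , true  , false) _ = refl
class-unique (true  , false , true ) _ = refl
class-unique (false , true  , true ) _ = refl

disjoint-self : ∀ s → isVertex s ≡ true → disjoint s s ≡ false
disjoint-self (true  , false , false) _ = refl
disjoint-self (false , true  , false) _ = refl
disjoint-self (false , false , true ) _ = refl
disjoint-self (true  , true  , false) _ = refl
disjoint-self (true  , false , true ) _ = refl
disjoint-self (false , true  , true ) _ = refl

disjoint-complement : ∀ s → isFull s ≡ false → not (isEmpty (complementˢ s)) ∧ disjoint s (complementˢ s) ≡ true
disjoint-complement (true  , true  , false) _ = refl
disjoint-complement (true  , false , true ) _ = refl
disjoint-complement (true  , false , false) _ = refl
disjoint-complement (false , true  , true ) _ = refl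
disjoint-complement (false , true  , false) _ = refl
disjoint-complement (false , false , true ) _ = refl
disjoint-complement (false , false , false) _ = refl

disjoint-full : ∀ s t → isFull s ≡ true → not (isEmpty t) ∧ disjoint s t ≡ false
disjoint-full (true  , true  , true ) t _ = ∧-inverseˡ (isEmpty t)
disjoint-full (true  , true  , false) t ()
disjoint-full (true  , false , _    ) t ()
disjoint-full (false , _     , _    ) t ()

dec-∧-subst : ∀ (g : Support → Bool) {s t} (s≟t : Dec (s ≡ t)) → does s≟t ∧ g s ≡ does s≟t ∧ g t
dec-∧-subst g (yes refl) = refl
dec-∧-subst g (no  _)    = refl

isVertex-∧-class : ∀ s t b → isVertex s ∧ (does (s ≟ˢ support t) ∧ b) ≡ does (s ≟ˢ support t) ∧ b
isVertex-∧-class s t b = go (s ≟ˢ support t)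
  where
    go : (s≟t : Dec (s ≡ support t)) → isVertex s ∧ (does s≟t ∧ b) ≡ does s≟t ∧ b
    go (yes refl) rewrite isVertex-support t = refl
    go (no  _)    = ∧-zeroʳ (isVertex s)

Σᵥ-disjoint : ∀ (N : VClass → ℕ) u → Σᵥ (λ t → if disjoint (support u) (support t) then N t else 0) ≡ nbr N u
Σᵥ-disjoint N A  = cong (λ x → N B + (N C + x)) (+-identityʳ (N BC))
Σᵥ-disjoint N B  = cong (λ x → N A + (N C + x)) (+-identityʳ (N AC))
Σᵥ-disjoint N C  = cong (λ x → N A + (N B + x)) (+-identityʳ (N AB))
Σᵥ-disjoint N AB = +-identityʳ (N C)
Σᵥ-disjoint N AC = +-identityʳ (N B)
Σᵥ-disjoint N BC = +-identityʳ (N A)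

bools : List Bool
bools = true ∷ false ∷ []

not-not∧not : ∀ x y → not (not x ∧ not y) ≡ x ∨ y
not-not∧not x y = trans (deMorgan₁ (not x) (not y)) (cong₂ _∨_ (not-involutive x) (not-involutive y))

module Z2×K×F {c₁ ℓ₁ c₂ ℓ₂} (K : FiniteField c₁ ℓ₁) (F : FiniteField c₂ ℓ₂) where
  private
    module K = FiniteField K
    module F = FiniteField F
    module Kᵖ = FiniteFieldProperties K
    module Fᵖ = FiniteFieldProperties F
  open FinRingData (Z2× K × F) using (Carrier; mul; isZero; eq; elems)
  open ZeroDivisorGraph (Z2× K × F)

  k f : ℕ
  k = K.size ∸ 1
  f = F.size ∸ 1

  supp : Carrier → Support
  supp (a , b , c) = a , not (K.isZero b) , not (F.isZero c)

  isZero-mul : ∀ v w → isZero (mul v w) ≡ disjoint (supp v) (supp w)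
  isZero-mul (a , b , c) (a′ , b′ , c′) = cong (not (a ∧ a′) ∧_) (cong₂ _∧_
    (trans (Kᵖ.isZero-* b b′) (sym (not-not∧not (K.isZero b) (K.isZero b′))))
    (trans (Fᵖ.isZero-* c c′) (sym (not-not∧not (F.isZero c) (F.isZero c′)))))

  isZero≡isEmpty : ∀ w → isZero w ≡ isEmpty (supp w)
  isZero≡isEmpty (a , b , c) =
    cong (not a ∧_) (sym (cong₂ _∧_ (not-involutive (K.isZero b)) (not-involutive (F.isZero c))))

  count-elems : ∀ (P : Bool → Bool) (Q : K.Carrier → Bool) (R : F.Carrier → Bool) →
                count (λ w → P (proj₁ w) ∧ (Q (proj₁ (proj₂ w)) ∧ R (proj₂ (proj₂ w)))) elems ≡
                count P bools * (count Q K.elems * count R F.elems)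
  count-elems P Q R = count-concatMap p (λ a → concatMap (λ b → map (λ c → (a , b , c)) F.elems) K.elems) P
                                      (count Q K.elems * count R F.elems) count-slice bools
    where
      p : Carrier → Bool
      p w = P (proj₁ w) ∧ (Q (proj₁ (proj₂ w)) ∧ R (proj₂ (proj₂ w)))

      count-line : ∀ a b → count p (map (λ c → (a , b , c)) F.elems) ≡ (if P a ∧ Q b then count R F.elems else 0)
      count-line a b = trans (count-map p (λ c → (a , b , c)) F.elems) (line (P a) (Q b))
        where
          line : ∀ x y → count (λ c → x ∧ (y ∧ R c)) F.elems ≡ (if x ∧ y then count R F.elems else 0)
          line true  true  = refl
          line true  false = count-false F.elems
          line false _     = count-false F.elems

      count-slice : ∀ a → count p (concatMap (λ b → map (λ c → (a , b , c)) F.elems) K.elems) ≡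
                          (if P a then count Q K.elems * count R F.elems else 0)
      count-slice a = trans (count-concatMap p _ (λ b → P a ∧ Q b) (count R F.elems) (count-line a) K.elems)
                            (slice (P a))
        where
          slice : ∀ x → count (λ b → x ∧ Q b) K.elems * count R F.elems ≡
                        (if x then count Q K.elems * count R F.elems else 0)
          slice true  = refl
          slice false = cong (_* count R F.elems) (count-false K.elems)

  count-support : ∀ s → count (λ w → does (supp w ≟ˢ s)) elems ≡
                  count (λ a → does (a ≟ᵇ proj₁ s)) bools *
                  (count (λ b → does (not (K.isZero b) ≟ᵇ proj₁ (proj₂ s))) K.elems *
                   count (λ c → does (not (F.isZero c) ≟ᵇ proj₂ (proj₂ s))) F.elems)
  count-support s = count-elems (λ a → does (a ≟ᵇ proj₁ s)) (λ b → does (not (K.isZero b) ≟ᵇ proj₁ (proj₂ s)))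
                                (λ c → does (not (F.isZero c) ≟ᵇ proj₂ (proj₂ s)))

  support-inhabited : ∀ s → 1 ≤ count (λ w → does (supp w ≟ˢ s)) elems
  support-inhabited (a , b , c) rewrite count-support (a , b , c) =
    *-mono-≤ (bit a) (*-mono-≤ (nonzero-is k Kᵖ.1≤size∸1 (Kᵖ.count-nonzero-is b))
                               (nonzero-is f Fᵖ.1≤size∸1 (Fᵖ.count-nonzero-is c)))
    where
      bit : ∀ a → 1 ≤ count (λ x → does (x ≟ᵇ a)) bools
      bit true  = ≤-refl
      bit false = ≤-refl
      nonzero-is : ∀ {b n} q → 1 ≤ q → n ≡ (if b then q else 1) → 1 ≤ n
      nonzero-is {true}  q 1≤q refl = 1≤q
      nonzero-is {false} q _   refl = ≤-refl

  count-class : ∀ t → count (λ w → does (supp w ≟ˢ support t)) elems ≡ classSize k f t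
  count-class t = trans (count-support (support t)) (size t)
    where
      size : ∀ t → count (λ a → does (a ≟ᵇ proj₁ (support t))) bools *
                   (count (λ b → does (not (K.isZero b) ≟ᵇ proj₁ (proj₂ (support t)))) K.elems *
                    count (λ c → does (not (F.isZero c) ≟ᵇ proj₂ (proj₂ (support t)))) F.elems)
                   ≡ classSize k f t
      size A  rewrite Kᵖ.count-nonzero-is false | Fᵖ.count-nonzero-is false = refl
      size B  rewrite Kᵖ.count-nonzero-is true  | Fᵖ.count-nonzero-is false = trans (+-identityʳ (k * 1)) (*-identityʳ k)
      size C  rewrite Kᵖ.count-nonzero-is false | Fᵖ.count-nonzero-is true  = trans (+-identityʳ (f + 0)) (+-identityʳ f)
      size AB rewrite Kᵖ.count-nonzero-is true  | Fᵖ.count-nonzero-is false = trans (+-identityʳ (k * 1)) (*-identityʳ k)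
      size AC rewrite Kᵖ.count-nonzero-is false | Fᵖ.count-nonzero-is true  = trans (+-identityʳ (f + 0)) (+-identityʳ f)
      size BC rewrite Kᵖ.count-nonzero-is true  | Fᵖ.count-nonzero-is true  = +-identityʳ (k * f)

  -- its equality test is literally the eq of Z2× K × F
  ringDecSetoid : DecSetoid (c₁ ⊔ c₂) (ℓ₁ ⊔ ℓ₂)
  ringDecSetoid = ×-decSetoid Bool.≡-decSetoid (×-decSetoid Kᵖ.decSetoid Fᵖ.decSetoid)

  elems-distinct : Distinct ringDecSetoid elems
  elems-distinct (a , b , c) = ≤-reflexive (begin
    count (λ w → does (DecSetoid._≟_ ringDecSetoid (a , b , c) w)) elems
      ≡⟨ count-elems (λ x → does (a ≟ᵇ x)) (λ y → does (b K.≟ y)) (λ z → does (c F.≟ z)) ⟩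
    count (λ x → does (a ≟ᵇ x)) bools * (count (λ y → does (b K.≟ y)) K.elems * count (λ z → does (c F.≟ z)) F.elems)
      ≡⟨ cong₂ (λ m n → count (λ x → does (a ≟ᵇ x)) bools * (m * n)) (K.complete b) (F.complete c) ⟩
    count (λ x → does (a ≟ᵇ x)) bools * 1
      ≡⟨ bit a ⟩
    1 ∎)
    where
      open ≡-Reasoning
      bit : ∀ a → count (λ x → does (a ≟ᵇ x)) bools * 1 ≡ 1
      bit true  = refl
      bit false = refl

  supp-resp : ∀ {v w} → DecSetoid._≈_ ringDecSetoid v w → supp v ≡ supp w
  supp-resp (a≡a′ , b≈b′ , c≈c′) =
    cong₂ _,_ a≡a′ (cong₂ _,_ (cong not (Kᵖ.isZero-resp-≈ b≈b′)) (cong not (Fᵖ.isZero-resp-≈ c≈c′)))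

  isZeroDivisor≡ : ∀ w → isZeroDivisor w ≡ not (isFull (supp w))
  isZeroDivisor≡ w = trans (cong or (map-cong annihilates≡ elems)) (go (isFull (supp w)) refl)
    where
      annihilates : Carrier → Bool
      annihilates y = not (isEmpty (supp y)) ∧ disjoint (supp w) (supp y)
      annihilates≡ : ∀ y → not (isZero y) ∧ isZero (mul w y) ≡ annihilates y
      annihilates≡ y = cong₂ _∧_ (cong not (isZero≡isEmpty y)) (isZero-mul w y)
      go : ∀ b → isFull (supp w) ≡ b → any annihilates elems ≡ not b
      go true  full     = any-false (λ y → disjoint-full (supp w) (supp y) full) elems
      go false not-full with count-witness elems (support-inhabited (complementˢ (supp w)))
      ... | y , y∈ , y-complement = any-true elems y∈ (trans
            (cong (λ s → not (isEmpty s) ∧ disjoint (supp w) s) (does⇒ (supp y ≟ˢ _) y-complement))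
            (disjoint-complement (supp w) not-full))

  V≡ : V ≡ filterᵇ (λ w → isVertex (supp w)) elems
  V≡ = filterᵇ-cong isVertex-supp elems
    where
      isVertex-supp : ∀ w → not (isZero w) ∧ isZeroDivisor w ≡ isVertex (supp w)
      isVertex-supp w = trans (cong₂ (λ x y → not x ∧ y) (isZero≡isEmpty w) (isZeroDivisor≡ w))
                              (sym (isVertex≡ (supp w)))

  ∈V⁻ : ∀ {w} → w ∈ V → w ∈ elems × isVertex (supp w) ≡ true
  ∈V⁻ w∈V = ∈-filterᵇ⁻ elems (subst (_ ∈_) V≡ w∈V)

  -- adjacency requires u ≠ v, but vertices with equal supports are not adjacent anyway
  adj≡disjoint : ∀ v w → isVertex (supp v) ≡ true → adj v w ≡ disjoint (supp v) (supp w)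
  adj≡disjoint v w v-vertex = go (eq v w) refl
    where
      go : ∀ b → eq v w ≡ b → not b ∧ isZero (mul v w) ≡ disjoint (supp v) (supp w)
      go false _   = isZero-mul v w
      go true  v≈w = sym (trans (cong (disjoint (supp v)) (sym (supp-resp (does⇒ (DecSetoid._≟_ ringDecSetoid v w) v≈w))))
                                (disjoint-self (supp v) v-vertex))

  classCount : (Carrier → Bool) → VClass → ℕ
  classCount T t = count (λ w → does (supp w ≟ˢ support t) ∧ T w) elems

  count-V : ∀ T → count T V ≡ Σᵥ (classCount T)
  count-V T = trans (count-partition T (λ w t → does (supp w ≟ˢ support t)) vertexClasses V
                                     (λ w∈V → class-unique _ (proj₂ (∈V⁻ w∈V))))
                    (Σᵥ-cong count-V-class)
    where
      count-V-class : ∀ t → count (λ w → does (supp w ≟ˢ support t) ∧ T w) V ≡ classCount T t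
      count-V-class t = begin
        count (λ w → does (supp w ≟ˢ support t) ∧ T w) V
          ≡⟨ cong (count _) V≡ ⟩
        count (λ w → does (supp w ≟ˢ support t) ∧ T w) (filterᵇ (λ w → isVertex (supp w)) elems)
          ≡⟨ count-filterᵇ _ _ elems ⟩
        count (λ w → isVertex (supp w) ∧ (does (supp w ≟ˢ support t) ∧ T w)) elems
          ≡⟨ count-cong (λ w → isVertex-∧-class (supp w) t (T w)) elems ⟩
        classCount T t ∎
        where open ≡-Reasoning

  δ≡nbr : ∀ T v u → supp v ≡ support u → δ T v ≡ nbr (classCount T) u
  δ≡nbr T v u v∈u = begin
    δ T v                                                                     ≡⟨ count-V (λ w → adj v w ∧ T w) ⟩
    Σᵥ (classCount (λ w → adj v w ∧ T w))                                      ≡⟨ Σᵥ-cong adjacent-in ⟩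
    Σᵥ (λ t → if disjoint (support u) (support t) then classCount T t else 0)  ≡⟨ Σᵥ-disjoint (classCount T) u ⟩
    nbr (classCount T) u                                                       ∎
    where
      open ≡-Reasoning
      v-vertex : isVertex (supp v) ≡ true
      v-vertex = trans (cong isVertex v∈u) (isVertex-support u)
      adjacent-in : ∀ t → classCount (λ w → adj v w ∧ T w) t ≡
                          (if disjoint (support u) (support t) then classCount T t else 0)
      adjacent-in t = begin
        count (λ w → does (supp w ≟ˢ support t) ∧ (adj v w ∧ T w)) elems
          ≡⟨ count-cong (λ w → cong (λ b → does (supp w ≟ˢ support t) ∧ (b ∧ T w))
                                    (trans (adj≡disjoint v w v-vertex) (cong (λ s → disjoint s (supp w)) v∈u))) elems ⟩
        count (λ w → does (supp w ≟ˢ support t) ∧ (disjoint (support u) (supp w) ∧ T w)) elems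
          ≡⟨ count-cong (λ w → dec-∧-subst (λ s → disjoint (support u) s ∧ T w) (supp w ≟ˢ support t)) elems ⟩
        count (λ w → does (supp w ≟ˢ support t) ∧ (disjoint (support u) (support t) ∧ T w)) elems
          ≡⟨ count-cong (λ w → ∧-x∧yz≈y∧xz (does (supp w ≟ˢ support t)) _ (T w)) elems ⟩
        count (λ w → disjoint (support u) (support t) ∧ (does (supp w ≟ˢ support t) ∧ T w)) elems
          ≡⟨ count-∧ˡ (disjoint (support u) (support t)) _ elems ⟩
        (if disjoint (support u) (support t) then classCount T t else 0) ∎

  splitOf : (Carrier → Bool) → Split k f
  splitOf S = record
    { inside    = classCount S
    ; outside   = classCount (complement S)
    ; partition = λ t → trans (count-∧-split _ S elems) (count-class t)
    }

  alliance⇒offensive : ∀ S → IsGlobalOffensiveAlliance S → Offensive (splitOf S)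
  alliance⇒offensive S (_ , alliance) t with classCount (complement S) t ≟ℕ 0
  ... | yes none-outside = inj₁ none-outside
  ... | no  some-outside with count-witness elems (n≢0⇒n>0 some-outside)
  ...   | w , w∈ , w-outside = inj₂ (≤-trans (≤-reflexive (+-comm 1 _))
            (subst₂ (λ x y → x + 1 ≤ y) (δ≡nbr (complement S) w t w∈t) (δ≡nbr S w t w∈t)
                    (All.lookup alliance w∈V Sw≡false)))
    where
      w∈t : supp w ≡ support t
      w∈t = does⇒ (supp w ≟ˢ support t) (∧-conicalˡ _ _ w-outside)
      Sw≡false : S w ≡ false
      Sw≡false = trans (sym (not-involutive (S w))) (cong not (∧-conicalʳ _ _ w-outside))
      w∈V : w ∈ V
      w∈V = subst (w ∈_) (sym V≡) (∈-filterᵇ⁺ elems w∈ (trans (cong isVertex w∈t) (isVertex-support t)))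

  offensive⇒alliance : ∀ S → 1 ≤ Σᵥ (classCount S) → Offensive (splitOf S) → IsGlobalOffensiveAlliance S
  offensive⇒alliance S nonempty offensive = subst (1 ≤_) (sym (count-V S)) nonempty , All.tabulate outside-ok
    where
      outside-ok : ∀ {w} → w ∈ V → S w ≡ false → δ (complement S) w + 1 ≤ δ S w
      outside-ok {w} w∈V Sw≡false with ∈V⁻ w∈V
      ... | w∈ , w-vertex with isVertex⇒support (supp w) w-vertex
      ...   | t , w∈t with offensive t
      ...     | inj₁ none-outside = contradiction
                  (trans (sym (cong₂ _∧_ (dec-true (supp w ≟ˢ support t) w∈t) (cong not Sw≡false)))
                         (count-≡0 elems none-outside w∈)) λ ()
      ...     | inj₂ nbr< = subst₂ (λ x y → x + 1 ≤ y) (sym (δ≡nbr (complement S) w t w∈t)) (sym (δ≡nbr S w t w∈t))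
                                   (≤-trans (≤-reflexive (+-comm _ 1)) nbr<)

  realize : (P : Split k f) → Σ[ S ∈ (Carrier → Bool) ] (∀ t → classCount S t ≡ Split.inside P t)
  realize P = S , S-inside
    where
      open Split P
      choice : ∀ t → Σ[ q ∈ (Carrier → Bool) ] count (λ w → does (supp w ≟ˢ support t) ∧ q w) elems ≡ inside t
      choice t = select ringDecSetoid (λ w → does (supp w ≟ˢ support t)) elems elems-distinct
                        (subst (inside t ≤_) (sym (count-class t)) (m+n≤o⇒m≤o (inside t) (≤-reflexive (partition t))))
      chosen : Maybe VClass → Carrier → Bool
      chosen t? w = maybe (λ t → proj₁ (choice t) w) false t?
      S : Carrier → Bool
      S w = chosen (classOf (supp w)) w
      S-inside : ∀ t → classCount S t ≡ inside t
      S-inside t = trans (count-cong (λ w → trans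
                     (dec-∧-subst (λ s → chosen (classOf s) w) (supp w ≟ˢ support t))
                     (cong (λ t? → does (supp w ≟ˢ support t) ∧ chosen t? w) (classOf-support t))) elems)
                   (proj₂ (choice t))

  alliance-of-split : (P : Split k f) → Offensive P → 1 ≤ Σᵥ (Split.inside P) →
                      Σ[ S ∈ (Carrier → Bool) ] IsGlobalOffensiveAlliance S × card S ≡ Σᵥ (Split.inside P)
  alliance-of-split P offensive nonempty with realize P
  ... | S , S-inside =
    S , offensive⇒alliance S (subst (1 ≤_) (sym (Σᵥ-cong S-inside)) nonempty)
                             (offensive-resp P (splitOf S) (λ t → sym (S-inside t)) S-outside offensive)
      , trans (count-V S) (Σᵥ-cong S-inside)
    where
      S-outside : ∀ t → Split.outside P t ≡ classCount (complement S) t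
      S-outside t = +-cancelˡ-≡ (Split.inside P t) _ _ (trans (Split.partition P t)
        (sym (trans (cong (_+ _) (sym (S-inside t))) (Split.partition (splitOf S) t))))

  γᵒ-attained : 1 ≤ f → Σ[ S ∈ (Carrier → Bool) ] IsGlobalOffensiveAlliance S × card S ≡ γᵒ-formula k f
  γᵒ-attained 1≤f with attains-γᵒ-min Kᵖ.1≤size∸1 1≤f
  ... | P , offensive , |P|≡ with alliance-of-split P offensive (subst (1 ≤_) (sym |P|≡) (s≤s z≤n))
  ...   | S , alliance , |S|≡|P| = S , alliance , trans |S|≡|P| |P|≡

  γᵒ-lower-bound : 2 ≤ f → ∀ S → IsGlobalOffensiveAlliance S → γᵒ-formula k f ≤ card S
  γᵒ-lower-bound 2≤f S alliance =
    subst (_ ≤_) (sym (count-V S)) (lower-bound Kᵖ.1≤size∸1 2≤f (splitOf S) (alliance⇒offensive S alliance))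

theorem2p11 : ∀ {c₁ ℓ₁ c₂ ℓ₂} (K : FiniteField c₁ ℓ₁) (F : FiniteField c₂ ℓ₂)
    → 3 ≤ FiniteField.size F
    → ZeroDivisorGraph.OffensiveAllianceNumberIs (Z2× K × F)
        (γᵒ-formula (FiniteField.size K ∸ 1) (FiniteField.size F ∸ 1))
theorem2p11 K F 3≤|F| = γᵒ-attained (≤-trans (s≤s z≤n) 2≤f) , γᵒ-lower-bound 2≤f
  where
    open Z2×K×F K F
    2≤f : 2 ≤ f
    2≤f = ∸-monoˡ-≤ 1 3≤|F|
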